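{- For nonnegative integers $n,m$, let $\overline{P}(n,m)$ be the number of overpartitions of $n$ with exactly $m$ missing integers (with $\overline{P}(0,0)=1$), and let $\overline{\mathcal{M}}_e(n)$ (resp. $\overline{\mathcal{M}}_o(n)$) be the number of overpartitions of $n$ with an even (resp. odd) number of missing integers. Then, for $|q|<1$, \[ \sum_{n=0}^{\infty}\sum_{m=0}^{\infty} \overline{P}(n,m)(-1)^mq^n=\sum_{n=0}^{\infty}\left(\overline{\mathcal{M}}_e(n)-\overline{\mathcal{M}}_o(n)\right)q^n=\frac{(-3q;q)_{\infty}}{(-q;q)_{\infty}}. \]
   Context: An overpartition of $n$ is a partition of $n$ in which the first occurrence of any integer may be overlined. The largest part is the largest integer occurring (overlined or not). A missing integer is a positive integer less than the largest part that occurs neither overlined nor non-overlined; the empty overpartition of $0$ has no missing integers. Notation: $(a;q)_\infty=\prod_{i\ge1}(1-aq^{i-1})$. -}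

module Defs where

open import Data.Nat as ℕ using (ℕ; zero; suc; _⊔_; _∸_; _≡ᵇ_; _≤ᵇ_)
open import Data.Nat.Base using () renaming (_*_ to _*ℕ_)
open import Data.Bool.ListAction using (any)
open import Data.Bool using (Bool; true; false; not; if_then_else_)
open import Data.Product using (_×_; _,_; proj₁)
open import Data.List using (List; []; _∷_; _++_; map; concatMap; replicate;
  length; filterᵇ; upTo; applyUpTo; foldr; zipWith)
open import Data.Integer as ℤ using (ℤ; +_; -_; _-_; _+_; _*_)

-- An overpartition is represented canonically as a list of parts
-- (size , overlined?) listed in weakly decreasing order of size; within
-- a block of equal parts, the (only possibly) overlined copy is the
-- first one.

even : ℕ → Bool
even zero          = true
even (suc zero)    = false
even (suc (suc n)) = even n

Overpartition : Set
Overpartition = List (ℕ × Bool)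

blocks : ℕ → ℕ → List Overpartition
blocks k zero    = [] ∷ []
blocks k (suc j) = ((k , true) ∷ replicate j (k , false))
                 ∷ replicate (suc j) (k , false) ∷ []

opsBelow : ℕ → ℕ → List Overpartition
opsBelow zero zero    = [] ∷ []
opsBelow zero (suc _) = []
opsBelow (suc k) n =
  concatMap
    (λ m → if (m *ℕ suc k) ≤ᵇ n
             then concatMap (λ b → map (b ++_) (opsBelow k (n ∸ (m *ℕ suc k))))
                            (blocks (suc k) m)
             else [])
    (upTo (suc n))

overpartitions : ℕ → List Overpartition
overpartitions n = opsBelow n n

largestPart : Overpartition → ℕ
largestPart o = foldr _⊔_ 0 (map proj₁ o)

occurs : ℕ → Overpartition → Bool
occurs k o = any (λ p → k ≡ᵇ p) (map proj₁ o)

missing : Overpartition → ℕ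
missing o = length (filterᵇ (λ k → not (occurs k o))
                            (applyUpTo suc (largestPart o ∸ 1)))

Pbar : ℕ → ℕ → ℕ
Pbar n m = length (filterᵇ (λ o → missing o ≡ᵇ m) (overpartitions n))

Me : ℕ → ℕ
Me n = length (filterᵇ (λ o → even (missing o)) (overpartitions n))

Mo : ℕ → ℕ
Mo n = length (filterᵇ (λ o → not (even (missing o))) (overpartitions n))

sum : List ℤ → ℤ
sum = foldr _+_ (+ 0)

Series : Set
Series = ℕ → ℤ

_⊛_ : Series → Series → Series
(f ⊛ g) n = sum (map (λ k → f k * g (n ∸ k)) (upTo (suc n)))

binom : ℤ → ℕ → Series
binom c i zero    = + 1
binom c i (suc n) = if suc n ≡ᵇ i then c else + 0

one : Series
one zero    = + 1
one (suc _) = + 0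

prodTo : ℤ → ℕ → Series
prodTo c zero    = one
prodTo c (suc N) = prodTo c N ⊛ binom c (suc N)

-- The infinite product  (-c q; q)_∞ = ∏_{i≥1} (1 + c q^i)  as a formal
-- power series: its q^n coefficient agrees with that of the finite
-- product ∏_{i=1}^{n} (1 + c q^i), since factors with i > n do not
-- contribute to q^n.
pochNeg : ℤ → Series
pochNeg c n = prodTo c n n

-- Multiplicative inverse of a series f with f 0 = 1:
-- b 0 = 1,  b n = - Σ_{k=1}^{n} f k * b (n - k).
-- invRev f n = [ b n , b (n-1) , … , b 0 ].
invRev : Series → ℕ → List ℤ
invRev f zero    = + 1 ∷ []
invRev f (suc n) =
  let bs = invRev f n in
  (- sum (zipWith _*_ (map f (applyUpTo suc (suc n))) bs)) ∷ bs

inv : Series → Series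
inv f n with invRev f n
... | []    = + 0
... | b ∷ _ = b

rhs : Series
rhs = pochNeg (+ 3) ⊛ inv (pochNeg (+ 1))

-- Σ_{m=0}^{n} P̄(n,m) (-1)^m   (P̄(n,m) = 0 for m > n).
signedSum : ℕ → ℤ
signedSum n = sum (map (λ m → (if even m then + 1 else - + 1) * + Pbar n m)
                       (upTo (suc n)))

-- Let D k (resp. W k) be the sum, over overpartitions with all parts ≤ k, of (-1) to the
-- number of integers in 1..k that do not occur (resp. of missing integers); both sums on
-- the left of the theorem are the coefficients of W ∞.  Splitting off the block of parts
-- equal to k+1 (any multiplicity ≥ 1, first copy overlined or not) gives
--   D (k+1) = - D k + 2 E k,   W (k+1) = W k + 2 E k,   E k = q^(k+1) (D k + E k).
-- Put G i = 1 + 2 Σ_{s ≥ 1} q^(i s) E (s-1), so that G 0 = W ∞ and G i ≡ 1 mod q^(i+1).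
-- These recurrences alone give G i (1 + q^(i+1)) = G (i+1) (1 + 3 q^(i+1)) (up to an error
-- divisible by q^((i+1)(K+1)) when the sum is truncated at s ≤ K), hence
-- W ∞ (-q;q)_n ≡ (-3q;q)_n mod q^(n+1) for every n, which is the product formula.
module Submission where

open import Algebra using (CommutativeSemiring)
open import Data.Nat as ℕ using (ℕ; zero; suc)
import Data.Nat.Properties as ℕ
open import Data.Product using (∃; ∃₂; _,_; proj₁; _×_)

module Telescoping {c ℓ} (R : CommutativeSemiring c ℓ) where
  open CommutativeSemiring R
  open import Algebra.Definitions.RawSemiring rawSemiring using (_^_)
  open import Algebra.Properties.Semiring.Exp semiring using (^-homo-*; ^-congʳ)
  open import Algebra.Solver.Ring.NaturalCoefficients.Default R using (solve; _:=_; _:+_; _:*_; con)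
  open import Relation.Binary.Reasoning.Setoid setoid

  -- Bracketed as the solver's constants `con 2` and `con 3` are.
  2# 3# : Carrier
  2# = 1# + 1#
  3# = 2# + 1#

  module _ (q : Carrier) where

    partialPoch : Carrier → ℕ → Carrier
    partialPoch a zero    = 1#
    partialPoch a (suc J) = partialPoch a J * (1# + a * q ^ suc J)

    module _ (D E : ℕ → Carrier) where

      G : ℕ → ℕ → Carrier
      G i zero    = 1#
      G i (suc K) = G i K + 2# * (q ^ (i ℕ.* suc K) * E K)

      module _ (D-zero : D 0 ≈ 1#)
               (D-suc : ∀ K → D (suc K) + D K ≈ 2# * E K)
               (E-geometric : ∀ K → E K ≈ q ^ suc K * (D K + E K))
               where

        E-absorb : ∀ i K → q ^ (i ℕ.* suc K) * E K ≈ q ^ (suc i ℕ.* suc K) * (D K + E K)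
        E-absorb i K = begin
          q ^ (i ℕ.* s) * E K                   ≈⟨ *-congˡ (E-geometric K) ⟩
          q ^ (i ℕ.* s) * (q ^ s * (D K + E K)) ≈⟨ *-assoc _ _ _ ⟨
          q ^ (i ℕ.* s) * q ^ s * (D K + E K)   ≈⟨ *-congʳ (*-comm _ _) ⟩
          q ^ s * q ^ (i ℕ.* s) * (D K + E K)   ≈⟨ *-congʳ (^-homo-* q s (i ℕ.* s)) ⟨
          q ^ (suc i ℕ.* s) * (D K + E K)       ∎
          where
          s : ℕ
          s = suc K

        -- The second summand on the left is the error of truncating G after K terms.
        G-step : ∀ i K → G i K * (1# + q ^ suc i) + 2# * (q ^ (suc i ℕ.* suc K) * D K)
                         ≈ G (suc i) K * (1# + 3# * q ^ suc i)
        G-step i zero = begin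
          1# * (1# + z) + 2# * (q ^ (suc i ℕ.* 1) * D 0)
            ≈⟨ +-congˡ (*-congˡ (*-cong (^-congʳ q (ℕ.*-identityʳ (suc i))) D-zero)) ⟩
          1# * (1# + z) + 2# * (z * 1#)
            ≈⟨ solve 1 (λ z → con 1 :* (con 1 :+ z) :+ con 2 :* (z :* con 1) := con 1 :* (con 1 :+ con 3 :* z))
                     refl z ⟩
          1# * (1# + 3# * z) ∎
          where
          z : Carrier
          z = q ^ suc i
        G-step i (suc K) = begin
          (A + 2# * (q ^ (i ℕ.* s) * e)) * (1# + z) + 2# * (q ^ (j ℕ.* suc s) * d′)
            ≈⟨ +-cong (*-congʳ (+-congˡ (*-congˡ (E-absorb i K)))) (*-congˡ (*-congʳ q^j[s+1])) ⟩
          (A + 2# * (w * (d + e))) * (1# + z) + 2# * (z * w * d′)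
            ≈⟨ solve 6 (λ A w d e z d′ →
                 (A :+ con 2 :* (w :* (d :+ e))) :* (con 1 :+ z) :+ con 2 :* (z :* w :* d′)
                 := (A :* (con 1 :+ z) :+ con 2 :* (w :* d)) :+ con 2 :* (w :* e) :+ con 2 :* (z :* w) :* (e :+ (d′ :+ d)))
                 refl A w d e z d′ ⟩
          (A * (1# + z) + 2# * (w * d)) + 2# * (w * e) + 2# * (z * w) * (e + (d′ + d))
            ≈⟨ +-cong (+-congʳ (G-step i K)) (*-congˡ (+-congˡ (D-suc K))) ⟩
          B * (1# + 3# * z) + 2# * (w * e) + 2# * (z * w) * (e + 2# * e)
            ≈⟨ solve 4 (λ B w e z →
                 B :* (con 1 :+ con 3 :* z) :+ con 2 :* (w :* e) :+ con 2 :* (z :* w) :* (e :+ con 2 :* e)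
                 := (B :+ con 2 :* (w :* e)) :* (con 1 :+ con 3 :* z))
                 refl B w e z ⟩
          (B + 2# * (w * e)) * (1# + 3# * z) ∎
          where
          s j : ℕ
          s = suc K
          j = suc i
          A B d d′ e z w : Carrier
          A = G i K
          B = G j K
          d = D K
          d′ = D s
          e = E K
          z = q ^ j
          w = q ^ (j ℕ.* s)
          q^j[s+1] : q ^ (j ℕ.* suc s) ≈ z * w
          q^j[s+1] = trans (^-congʳ q (ℕ.*-suc j s)) (^-homo-* q j (j ℕ.* s))

        G≡1-mod : ∀ i K → ∃ λ f → G i K ≈ 1# + q ^ suc i * f
        G≡1-mod i zero    = 0# , solve 1 (λ z → con 1 := con 1 :+ z :* con 0) refl (q ^ suc i)
        G≡1-mod i (suc K) with G≡1-mod i K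
        ... | f , G≈ = f + 2# * (v * u) , (begin
          G i K + 2# * (q ^ (i ℕ.* suc K) * E K)          ≈⟨ +-cong G≈ (*-congˡ (E-absorb i K)) ⟩
          1# + z * f + 2# * (q ^ (suc i ℕ.* suc K) * u)   ≈⟨ +-congˡ (*-congˡ (*-congʳ q^[i+1][K+1])) ⟩
          1# + z * f + 2# * (z * v * u)                   ≈⟨ solve 4 (λ z f v u →
                                                               con 1 :+ z :* f :+ con 2 :* (z :* v :* u)
                                                               := con 1 :+ z :* (f :+ con 2 :* (v :* u)))
                                                               refl z f v u ⟩
          1# + z * (f + 2# * (v * u))                     ∎)
          where
          z u v : Carrier
          z = q ^ suc i
          u = D K + E K
          v = q ^ (suc i ℕ.* K)
          q^[i+1][K+1] : q ^ (suc i ℕ.* suc K) ≈ z * v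
          q^[i+1][K+1] = trans (^-congʳ q (ℕ.*-suc (suc i) K)) (^-homo-* q (suc i) (suc i ℕ.* K))

        telescope : ∀ J K → ∃ λ e → G 0 K * partialPoch 1# J + q ^ suc K * e ≈ partialPoch 3# J * G J K
        telescope zero K = 0# , solve 2 (λ g y → g :* con 1 :+ y :* con 0 := con 1 :* g) refl (G 0 K) (q ^ suc K)
        telescope (suc J) K with telescope J K
        ... | e , eq = e * (1# + z) + 2# * (P₃ * (t * D K)) , (begin
          G 0 K * (P₁ * (1# + 1# * z)) + y * (e * (1# + z) + 2# * (P₃ * (t * D K)))
            ≈⟨ solve 8 (λ g P₁ z y e P₃ t d →
                 g :* (P₁ :* (con 1 :+ con 1 :* z)) :+ y :* (e :* (con 1 :+ z) :+ con 2 :* (P₃ :* (t :* d)))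
                 := (g :* P₁ :+ y :* e) :* (con 1 :+ z) :+ con 2 :* (P₃ :* ((y :* t) :* d)))
                 refl (G 0 K) P₁ z y e P₃ t (D K) ⟩
          (G 0 K * P₁ + y * e) * (1# + z) + 2# * (P₃ * ((y * t) * D K))
            ≈⟨ +-cong (*-congʳ eq) (*-congˡ (*-congˡ (*-congʳ (sym (^-homo-* q (suc K) (J ℕ.* suc K)))))) ⟩
          P₃ * G J K * (1# + z) + 2# * (P₃ * (q ^ (suc J ℕ.* suc K) * D K))
            ≈⟨ solve 4 (λ P₃ g z x → P₃ :* g :* (con 1 :+ z) :+ con 2 :* (P₃ :* x) := P₃ :* (g :* (con 1 :+ z) :+ con 2 :* x))
                 refl P₃ (G J K) z (q ^ (suc J ℕ.* suc K) * D K) ⟩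
          P₃ * (G J K * (1# + z) + 2# * (q ^ (suc J ℕ.* suc K) * D K))
            ≈⟨ *-congˡ (G-step J K) ⟩
          P₃ * (G (suc J) K * (1# + 3# * z))
            ≈⟨ solve 3 (λ P₃ g z → P₃ :* (g :* (con 1 :+ con 3 :* z)) := P₃ :* (con 1 :+ con 3 :* z) :* g)
                 refl P₃ (G (suc J) K) z ⟩
          P₃ * (1# + 3# * z) * G (suc J) K ∎)
          where
          z y t P₁ P₃ : Carrier
          z = q ^ suc J
          y = q ^ suc K
          t = q ^ (J ℕ.* suc K)
          P₁ = partialPoch 1# J
          P₃ = partialPoch 3# J

        product-congruence : ∀ n → ∃₂ λ e f → G 0 n * partialPoch 1# n + q ^ suc n * e ≈ partialPoch 3# n + q ^ suc n * f
        product-congruence n with telescope n n | G≡1-mod n n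
        ... | e , chain | f , G≈ = e , P₃ * f , (begin
          G 0 n * partialPoch 1# n + q ^ suc n * e ≈⟨ chain ⟩
          P₃ * G n n                               ≈⟨ *-congˡ G≈ ⟩
          P₃ * (1# + q ^ suc n * f)                ≈⟨ solve 3 (λ P₃ y f → P₃ :* (con 1 :+ y :* f) := P₃ :+ y :* (P₃ :* f))
                                                              refl P₃ (q ^ suc n) f ⟩
          P₃ + q ^ suc n * (P₃ * f)                ∎)
          where
          P₃ : Carrier
          P₃ = partialPoch 3# n

-- Imported only after `Telescoping`, whose semiring operations they would shadow.
open import Defs
import Algebra.Construct.Pointwise as Pointwise
open import Data.Nat using (_≤_; _<_; z≤n; s≤s; _∸_; _⊔_)
open import Data.Integer as ℤ using (ℤ; +_; -_; _+_; _*_; _-_)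
import Data.Integer.Properties as ℤ
open import Algebra.Properties.CommutativeSemigroup ℤ.+-commutativeSemigroup using (interchange)
open import Data.Integer.Tactic.RingSolver using (solve-∀)
open import Data.List using (List; []; _∷_; _++_; _∷ʳ_; map; concatMap; replicate; foldr; length; filterᵇ;
                             applyUpTo; upTo; downFrom; zipWith)
import Data.List.Properties as List
open import Data.List.Relation.Unary.All using (All; []; _∷_)
import Data.List.Relation.Unary.All as All
import Data.List.Relation.Unary.All.Properties as All
open import Data.Bool using (Bool; true; false; if_then_else_; T; T?; not; _∨_)
import Data.Bool.Properties as Bool
open import Data.Bool.ListAction using (any)
open import Function using (_∘_; id)
open import Level using (0ℓ)
open import Relation.Nullary using (contradiction)
open import Relation.Binary.PropositionalEquality
  using (_≡_; _≢_; refl; sym; trans; cong; cong₂; subst; _≗_; _→-setoid_; module ≡-Reasoning)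
open import Algebra.Consequences.Setoid (ℕ →-setoid ℤ) using (comm∧idˡ⇒id; comm∧zeˡ⇒ze; comm∧distrʳ⇒distr)

∑ : ℕ → (ℕ → ℤ) → ℤ
∑ n h = sum (applyUpTo h n)

∑-cong : ∀ n {h h′ : ℕ → ℤ} → (∀ k → k < n → h k ≡ h′ k) → ∑ n h ≡ ∑ n h′
∑-cong zero    eq = refl
∑-cong (suc n) eq = cong₂ _+_ (eq 0 (s≤s z≤n)) (∑-cong n (λ k k<n → eq (suc k) (s≤s k<n)))

∑-zero : ∀ n {h : ℕ → ℤ} → (∀ k → k < n → h k ≡ + 0) → ∑ n h ≡ + 0
∑-zero zero    eq = refl
∑-zero (suc n) eq = cong₂ _+_ (eq 0 (s≤s z≤n)) (∑-zero n (λ k k<n → eq (suc k) (s≤s k<n)))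

∑-distrib-+ : ∀ n (h h′ : ℕ → ℤ) → ∑ n (λ k → h k + h′ k) ≡ ∑ n h + ∑ n h′
∑-distrib-+ zero    h h′ = refl
∑-distrib-+ (suc n) h h′ = trans (cong (_+_ (h 0 + h′ 0)) (∑-distrib-+ n (h ∘ suc) (h′ ∘ suc)))
                                 (interchange (h 0) (h′ 0) _ _)

∑-distribˡ-* : ∀ n c (h : ℕ → ℤ) → ∑ n (λ k → c * h k) ≡ c * ∑ n h
∑-distribˡ-* zero    c h = sym (ℤ.*-zeroʳ c)
∑-distribˡ-* (suc n) c h = trans (cong (_+_ (c * h 0)) (∑-distribˡ-* n c (h ∘ suc)))
                                 (sym (ℤ.*-distribˡ-+ c (h 0) _))

∑-last : ∀ n (h : ℕ → ℤ) → ∑ (suc n) h ≡ ∑ n h + h n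
∑-last zero    h = trans (ℤ.+-identityʳ (h 0)) (sym (ℤ.+-identityˡ (h 0)))
∑-last (suc n) h = trans (cong (_+_ (h 0)) (∑-last n (h ∘ suc))) (sym (ℤ.+-assoc (h 0) _ _))

∑-reverse : ∀ n (h : ℕ → ℤ) → ∑ (suc n) (λ k → h (n ∸ k)) ≡ ∑ (suc n) h
∑-reverse zero    h = refl
∑-reverse (suc n) h = begin
  h (suc n) + ∑ (suc n) (λ k → h (n ∸ k)) ≡⟨ cong (_+_ (h (suc n))) (∑-reverse n h) ⟩
  h (suc n) + ∑ (suc n) h                 ≡⟨ ℤ.+-comm (h (suc n)) _ ⟩
  ∑ (suc n) h + h (suc n)                 ≡⟨ ∑-last (suc n) h ⟨
  ∑ (suc (suc n)) h                       ∎
  where open ≡-Reasoning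

∑-vanishing-tail : ∀ B n (h : ℕ → ℤ) → n ≤ B → (∀ m → n ≤ m → h m ≡ + 0) → ∑ B h ≡ ∑ n h
∑-vanishing-tail B zero h _ eq = ∑-zero B (λ m _ → eq m z≤n)
∑-vanishing-tail (suc B) (suc n) h (s≤s n≤B) eq =
  cong (_+_ (h 0)) (∑-vanishing-tail B n (h ∘ suc) n≤B (λ m n≤m → eq (suc m) (s≤s n≤m)))

∑-indicator : ∀ N x (c : ℕ → ℤ) → x < N → ∑ N (λ m → c m * (if x ℕ.≡ᵇ m then + 1 else + 0)) ≡ c x
∑-indicator (suc N) zero    c _ =
  trans (cong₂ _+_ (ℤ.*-identityʳ (c 0)) (∑-zero N (λ m _ → ℤ.*-zeroʳ (c (suc m))))) (ℤ.+-identityʳ (c 0))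
∑-indicator (suc N) (suc x) c (s≤s x<N) =
  trans (cong₂ _+_ (ℤ.*-zeroʳ (c 0)) (∑-indicator N x (c ∘ suc) x<N)) (ℤ.+-identityˡ (c (suc x)))

∑-sum-comm : ∀ {A : Set} N (h : ℕ → A → ℤ) xs →
             ∑ N (λ m → sum (map (h m) xs)) ≡ sum (map (λ x → ∑ N (λ m → h m x)) xs)
∑-sum-comm N h []       = ∑-zero N (λ _ _ → refl)
∑-sum-comm N h (x ∷ xs) = trans (∑-distrib-+ N (λ m → h m x) (λ m → sum (map (h m) xs)))
                                (cong (_+_ (∑ N (λ m → h m x))) (∑-sum-comm N h xs))

sum-++ : ∀ xs ys → sum (xs ++ ys) ≡ sum xs + sum ys
sum-++ []       ys = sym (ℤ.+-identityˡ (sum ys))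
sum-++ (x ∷ xs) ys = trans (cong (_+_ x) (sum-++ xs ys)) (sym (ℤ.+-assoc x (sum xs) (sum ys)))

sum-map-++ : ∀ {A : Set} (w : A → ℤ) xs ys → sum (map w (xs ++ ys)) ≡ sum (map w xs) + sum (map w ys)
sum-map-++ w xs ys = trans (cong sum (List.map-++ w xs ys)) (sum-++ (map w xs) (map w ys))

sum-map-concatMap : ∀ {A B : Set} (w : B → ℤ) (F : A → List B) xs →
                    sum (map w (concatMap F xs)) ≡ sum (map (λ x → sum (map w (F x))) xs)
sum-map-concatMap w F []       = refl
sum-map-concatMap w F (x ∷ xs) =
  trans (sum-map-++ w (F x) (concatMap F xs)) (cong (_+_ (sum (map w (F x)))) (sum-map-concatMap w F xs))

sum-map-cong : ∀ {A : Set} {v w : A → ℤ} {xs} → All (λ x → v x ≡ w x) xs → sum (map v xs) ≡ sum (map w xs)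
sum-map-cong []         = refl
sum-map-cong (eq ∷ eqs) = cong₂ _+_ eq (sum-map-cong eqs)

sum-map-neg : ∀ {A : Set} (w : A → ℤ) xs → sum (map (λ x → - w x) xs) ≡ - sum (map w xs)
sum-map-neg w []       = refl
sum-map-neg w (x ∷ xs) = trans (cong (_+_ (- w x)) (sum-map-neg w xs)) (sym (ℤ.neg-distrib-+ (w x) _))

sum-map-* : ∀ {A : Set} c (w : A → ℤ) xs → sum (map (λ x → c * w x) xs) ≡ c * sum (map w xs)
sum-map-* c w []       = sym (ℤ.*-zeroʳ c)
sum-map-* c w (x ∷ xs) = trans (cong (_+_ (c * w x)) (sum-map-* c w xs)) (sym (ℤ.*-distribˡ-+ c (w x) _))

count-as-sum : ∀ {A : Set} (p : A → Bool) xs → + length (filterᵇ p xs) ≡ sum (map (λ x → if p x then + 1 else + 0) xs)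
count-as-sum p []       = refl
count-as-sum p (x ∷ xs) with p x
... | true  = cong (_+_ (+ 1)) (count-as-sum p xs)
... | false = trans (count-as-sum p xs) (sym (ℤ.+-identityˡ _))

count-difference : ∀ {A : Set} (p : A → Bool) xs →
  + length (filterᵇ p xs) - + length (filterᵇ (not ∘ p) xs) ≡ sum (map (λ x → if p x then + 1 else - + 1) xs)
count-difference p []       = refl
count-difference p (x ∷ xs) with p x
... | true  = trans (ℤ.+-assoc (+ 1) (+ length (filterᵇ p xs)) (- + length (filterᵇ (not ∘ p) xs)))
                    (cong (_+_ (+ 1)) (count-difference p xs))
... | false = trans (sub-suc (+ length (filterᵇ p xs)) (+ length (filterᵇ (not ∘ p) xs)))
                    (cong (_+_ (- + 1)) (count-difference p xs))
  where
  sub-suc : ∀ a b → a - (+ 1 + b) ≡ - + 1 + (a - b)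
  sub-suc = solve-∀

-- The semiring of formal power series

infixl 6 _+ˢ_
_+ˢ_ : Series → Series → Series
(f +ˢ g) n = f n + g n

0ˢ : Series
0ˢ _ = + 0

⊛-∑ : ∀ f g n → (f ⊛ g) n ≡ ∑ (suc n) (λ k → f k * g (n ∸ k))
⊛-∑ f g n = cong sum (List.map-upTo (λ k → f k * g (n ∸ k)) (suc n))

⊛-zero : ∀ f g → (f ⊛ g) 0 ≡ f 0 * g 0
⊛-zero f g = ℤ.+-identityʳ (f 0 * g 0)

⊛-suc : ∀ f g n → (f ⊛ g) (suc n) ≡ f 0 * g (suc n) + ((f ∘ suc) ⊛ g) n
⊛-suc f g n = trans (⊛-∑ f g (suc n)) (cong (_+_ (f 0 * g (suc n))) (sym (⊛-∑ (f ∘ suc) g n)))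

⊛-cong≤ : ∀ n {f f′ g g′ : Series} → (∀ k → k ≤ n → f k ≡ f′ k) → (∀ k → k ≤ n → g k ≡ g′ k) →
          (f ⊛ g) n ≡ (f′ ⊛ g′) n
⊛-cong≤ n {f} {f′} {g} {g′} f≈ g≈ = begin
  (f ⊛ g) n                             ≡⟨ ⊛-∑ f g n ⟩
  ∑ (suc n) (λ k → f k * g (n ∸ k))     ≡⟨ ∑-cong (suc n) (λ k k≤n → cong₂ _*_ (f≈ k (ℕ.≤-pred k≤n))
                                                                             (g≈ (n ∸ k) (ℕ.m∸n≤m n k))) ⟩
  ∑ (suc n) (λ k → f′ k * g′ (n ∸ k))   ≡⟨ ⊛-∑ f′ g′ n ⟨
  (f′ ⊛ g′) n                           ∎
  where open ≡-Reasoning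

⊛-comm : ∀ f g → (f ⊛ g) ≗ (g ⊛ f)
⊛-comm f g n = begin
  (f ⊛ g) n                                     ≡⟨ ⊛-∑ f g n ⟩
  ∑ (suc n) (λ k → f k * g (n ∸ k))             ≡⟨ ∑-reverse n (λ k → f k * g (n ∸ k)) ⟨
  ∑ (suc n) (λ k → f (n ∸ k) * g (n ∸ (n ∸ k))) ≡⟨ ∑-cong (suc n) (λ k k≤n → swap k (ℕ.≤-pred k≤n)) ⟩
  ∑ (suc n) (λ k → g k * f (n ∸ k))             ≡⟨ ⊛-∑ g f n ⟨
  (g ⊛ f) n                                     ∎
  where
  open ≡-Reasoning
  swap : ∀ k → k ≤ n → f (n ∸ k) * g (n ∸ (n ∸ k)) ≡ g k * f (n ∸ k)
  swap k k≤n = trans (cong (λ i → f (n ∸ k) * g i) (ℕ.m∸[m∸n]≡n k≤n)) (ℤ.*-comm (f (n ∸ k)) (g k))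

⊛-distribʳ : ∀ h f g → ((f +ˢ g) ⊛ h) ≗ ((f ⊛ h) +ˢ (g ⊛ h))
⊛-distribʳ h f g n = begin
  ((f +ˢ g) ⊛ h) n
    ≡⟨ ⊛-∑ (f +ˢ g) h n ⟩
  ∑ (suc n) (λ k → (f k + g k) * h (n ∸ k))
    ≡⟨ ∑-cong (suc n) (λ k _ → ℤ.*-distribʳ-+ (h (n ∸ k)) (f k) (g k)) ⟩
  ∑ (suc n) (λ k → f k * h (n ∸ k) + g k * h (n ∸ k))
    ≡⟨ ∑-distrib-+ (suc n) (λ k → f k * h (n ∸ k)) (λ k → g k * h (n ∸ k)) ⟩
  ∑ (suc n) (λ k → f k * h (n ∸ k)) + ∑ (suc n) (λ k → g k * h (n ∸ k))
    ≡⟨ cong₂ _+_ (⊛-∑ f h n) (⊛-∑ g h n) ⟨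
  (f ⊛ h) n + (g ⊛ h) n
    ∎
  where open ≡-Reasoning

⊛-scalarˡ : ∀ c f g n → ((λ k → c * f k) ⊛ g) n ≡ c * (f ⊛ g) n
⊛-scalarˡ c f g n = begin
  ((λ k → c * f k) ⊛ g) n                  ≡⟨ ⊛-∑ (λ k → c * f k) g n ⟩
  ∑ (suc n) (λ k → c * f k * g (n ∸ k))     ≡⟨ ∑-cong (suc n) (λ k _ → ℤ.*-assoc c (f k) (g (n ∸ k))) ⟩
  ∑ (suc n) (λ k → c * (f k * g (n ∸ k)))   ≡⟨ ∑-distribˡ-* (suc n) c (λ k → f k * g (n ∸ k)) ⟩
  c * ∑ (suc n) (λ k → f k * g (n ∸ k))     ≡⟨ cong (c *_) (⊛-∑ f g n) ⟨
  c * (f ⊛ g) n                             ∎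
  where open ≡-Reasoning

⊛-zeroˡ : ∀ f → (0ˢ ⊛ f) ≗ 0ˢ
⊛-zeroˡ f n = trans (⊛-∑ 0ˢ f n) (∑-zero (suc n) (λ _ _ → refl))

⊛-identityˡ : ∀ f → (one ⊛ f) ≗ f
⊛-identityˡ f zero    = trans (⊛-zero one f) (ℤ.*-identityˡ (f 0))
⊛-identityˡ f (suc n) = begin
  (one ⊛ f) (suc n)                   ≡⟨ ⊛-suc one f n ⟩
  + 1 * f (suc n) + (0ˢ ⊛ f) n        ≡⟨ cong₂ _+_ (ℤ.*-identityˡ (f (suc n))) (⊛-zeroˡ f n) ⟩
  f (suc n) + + 0                     ≡⟨ ℤ.+-identityʳ (f (suc n)) ⟩
  f (suc n)                           ∎
  where open ≡-Reasoning

⊛-assoc : ∀ f g h → ((f ⊛ g) ⊛ h) ≗ (f ⊛ (g ⊛ h))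
⊛-assoc f g h zero    = begin
  ((f ⊛ g) ⊛ h) 0      ≡⟨ trans (⊛-zero (f ⊛ g) h) (cong (_* h 0) (⊛-zero f g)) ⟩
  f 0 * g 0 * h 0      ≡⟨ ℤ.*-assoc (f 0) (g 0) (h 0) ⟩
  f 0 * (g 0 * h 0)    ≡⟨ trans (⊛-zero f (g ⊛ h)) (cong (f 0 *_) (⊛-zero g h)) ⟨
  (f ⊛ (g ⊛ h)) 0      ∎
  where open ≡-Reasoning
⊛-assoc f g h (suc n) = begin
  ((f ⊛ g) ⊛ h) (suc n)
    ≡⟨ ⊛-suc (f ⊛ g) h n ⟩
  (f ⊛ g) 0 * h (suc n) + (((f ⊛ g) ∘ suc) ⊛ h) n
    ≡⟨ cong₂ _+_ (cong (_* h (suc n)) (⊛-zero f g)) (⊛-cong≤ n {g = h} (λ k _ → ⊛-suc f g k) (λ _ _ → refl)) ⟩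
  a * b * c + ((f₀g′ +ˢ ((f ∘ suc) ⊛ g)) ⊛ h) n
    ≡⟨ cong (_+_ (a * b * c)) (⊛-distribʳ h f₀g′ ((f ∘ suc) ⊛ g) n) ⟩
  a * b * c + ((f₀g′ ⊛ h) n + (((f ∘ suc) ⊛ g) ⊛ h) n)
    ≡⟨ cong (_+_ (a * b * c)) (cong₂ _+_ (⊛-scalarˡ a (g ∘ suc) h n) (⊛-assoc (f ∘ suc) g h n)) ⟩
  a * b * c + (a * ((g ∘ suc) ⊛ h) n + ((f ∘ suc) ⊛ (g ⊛ h)) n)
    ≡⟨ regroup a b c _ _ ⟩
  a * (b * c + ((g ∘ suc) ⊛ h) n) + ((f ∘ suc) ⊛ (g ⊛ h)) n
    ≡⟨ cong (λ x → a * x + ((f ∘ suc) ⊛ (g ⊛ h)) n) (⊛-suc g h n) ⟨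
  a * (g ⊛ h) (suc n) + ((f ∘ suc) ⊛ (g ⊛ h)) n
    ≡⟨ ⊛-suc f (g ⊛ h) n ⟨
  (f ⊛ (g ⊛ h)) (suc n) ∎
  where
  open ≡-Reasoning
  a b c : ℤ
  a = f 0
  b = g 0
  c = h (suc n)
  f₀g′ : Series
  f₀g′ k = a * g (suc k)
  regroup : ∀ a b c x y → a * b * c + (a * x + y) ≡ a * (b * c + x) + y
  regroup = solve-∀

seriesSemiring : CommutativeSemiring 0ℓ 0ℓ
seriesSemiring = record
  { Carrier = Series
  ; _≈_     = _≗_
  ; _+_     = _+ˢ_
  ; _*_     = _⊛_
  ; 0#      = 0ˢ
  ; 1#      = one
  ; isCommutativeSemiring = record
    { isSemiring = record
      { isSemiringWithoutAnnihilatingZero = record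
        { +-isCommutativeMonoid = Pointwise.isCommutativeMonoid ℕ ℤ.+-0-isCommutativeMonoid
        ; *-cong     = λ f≈ g≈ n → ⊛-cong≤ n (λ k _ → f≈ k) (λ k _ → g≈ k)
        ; *-assoc    = ⊛-assoc
        ; *-identity = comm∧idˡ⇒id ⊛-comm ⊛-identityˡ
        ; distrib    = comm∧distrʳ⇒distr (λ f≈ g≈ n → cong₂ _+_ (f≈ n) (g≈ n)) ⊛-comm ⊛-distribʳ
        }
      ; zero = comm∧zeˡ⇒ze ⊛-comm ⊛-zeroˡ
      }
    ; *-comm = ⊛-comm
    }
  }

module ˢ = CommutativeSemiring seriesSemiring
open import Algebra.Definitions.RawSemiring ˢ.rawSemiring using (_^_)
open Telescoping seriesSemiring using (2#; 3#; partialPoch; G; product-congruence)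

shift : ℕ → Series → Series
shift zero    f n       = f n
shift (suc a) f zero    = + 0
shift (suc a) f (suc n) = shift a f n

q : Series
q = shift 1 one

shift-below : ∀ a f n → n < a → shift a f n ≡ + 0
shift-below (suc a) f zero    _         = refl
shift-below (suc a) f (suc n) (s≤s n<a) = shift-below a f n n<a

shift-cong : ∀ a {f g : Series} → f ≗ g → shift a f ≗ shift a g
shift-cong zero    f≗g n       = f≗g n
shift-cong (suc a) f≗g zero    = refl
shift-cong (suc a) f≗g (suc n) = shift-cong a f≗g n

shift-cong< : ∀ a n {f g : Series} → (∀ t → t < n → f t ≡ g t) → shift (suc a) f n ≡ shift (suc a) g n
shift-cong< a       zero    eq = refl
shift-cong< zero    (suc n) eq = eq n (ℕ.n<1+n n)
shift-cong< (suc a) (suc n) eq = shift-cong< a n (λ t t<n → eq t (ℕ.m<n⇒m<1+n t<n))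

shift-+ : ∀ a b f n → shift (a ℕ.+ b) f n ≡ shift a (shift b f) n
shift-+ zero    b f n       = refl
shift-+ (suc a) b f zero    = refl
shift-+ (suc a) b f (suc n) = shift-+ a b f n

shift-* : ∀ a c f n → shift a (λ t → c * f t) n ≡ c * shift a f n
shift-* zero    c f n       = refl
shift-* (suc a) c f zero    = sym (ℤ.*-zeroʳ c)
shift-* (suc a) c f (suc n) = shift-* a c f n

shift-∑ : ∀ a N (h : ℕ → Series) n → shift a (λ t → ∑ N (λ m → h m t)) n ≡ ∑ N (λ m → shift a (h m) n)
shift-∑ zero    N h n       = refl
shift-∑ (suc a) N h zero    = sym (∑-zero N (λ _ _ → refl))
shift-∑ (suc a) N h (suc n) = shift-∑ a N h n

shift-if : ∀ a f n → (if a ℕ.≤ᵇ n then f (n ∸ a) else + 0) ≡ shift a f n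
shift-if zero          f n       = refl
shift-if (suc a)       f zero    = refl
shift-if (suc zero)    f (suc n) = refl
shift-if (suc (suc a)) f (suc n) = shift-if (suc a) f n

shift-one : ∀ a n → shift a one n ≡ (if n ℕ.≡ᵇ a then + 1 else + 0)
shift-one zero    zero    = refl
shift-one zero    (suc n) = refl
shift-one (suc a) zero    = refl
shift-one (suc a) (suc n) = shift-one a n

shift-⊛ : ∀ a f g n → (shift a f ⊛ g) n ≡ shift a (f ⊛ g) n
shift-⊛ zero    f g n       = refl
shift-⊛ (suc a) f g zero    = trans (⊛-zero (shift (suc a) f) g) (ℤ.*-zeroˡ (g 0))
shift-⊛ (suc a) f g (suc n) = begin
  (shift (suc a) f ⊛ g) (suc n)          ≡⟨ ⊛-suc (shift (suc a) f) g n ⟩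
  + 0 * g (suc n) + (shift a f ⊛ g) n    ≡⟨ cong₂ _+_ (ℤ.*-zeroˡ (g (suc n))) (shift-⊛ a f g n) ⟩
  + 0 + shift a (f ⊛ g) n                ≡⟨ ℤ.+-identityˡ _ ⟩
  shift a (f ⊛ g) n                      ∎
  where open ≡-Reasoning

q^-shift : ∀ a → q ^ a ≗ shift a one
q^-shift zero    n = refl
q^-shift (suc a) n = begin
  (q ⊛ (q ^ a)) n            ≡⟨ shift-⊛ 1 one (q ^ a) n ⟩
  shift 1 (one ⊛ (q ^ a)) n  ≡⟨ shift-cong 1 (λ t → trans (⊛-identityˡ (q ^ a) t) (q^-shift a t)) n ⟩
  shift 1 (shift a one) n    ≡⟨ shift-+ 1 a one n ⟨
  shift (suc a) one n        ∎
  where open ≡-Reasoning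

q^-⊛ : ∀ a f n → ((q ^ a) ⊛ f) n ≡ shift a f n
q^-⊛ a f n = begin
  ((q ^ a) ⊛ f) n        ≡⟨ ⊛-cong≤ n {g = f} (λ k _ → q^-shift a k) (λ _ _ → refl) ⟩
  (shift a one ⊛ f) n    ≡⟨ shift-⊛ a one f n ⟩
  shift a (one ⊛ f) n    ≡⟨ shift-cong a (⊛-identityˡ f) n ⟩
  shift a f n            ∎
  where open ≡-Reasoning

coefficient-mod-q^ : ∀ n a b → (∃₂ λ e f → (a +ˢ ((q ^ suc n) ⊛ e)) ≗ (b +ˢ ((q ^ suc n) ⊛ f))) → a n ≡ b n
coefficient-mod-q^ n a b (e , f , a≡b) = trans (sym (drop-multiple a e)) (trans (a≡b n) (drop-multiple b f))
  where
  drop-multiple : ∀ c e → (c +ˢ ((q ^ suc n) ⊛ e)) n ≡ c n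
  drop-multiple c e = trans (cong (_+_ (c n)) (trans (q^-⊛ (suc n) e n) (shift-below (suc n) e n (ℕ.n<1+n n))))
                            (ℤ.+-identityʳ (c n))

-- Σ_{m ≥ 1} q^(m L) g for L ≥ 1: at degree n only the terms with m ≤ n contribute.
geometric : ℕ → Series → Series
geometric L g n = ∑ n (λ m → shift (suc m ℕ.* L) g n)

geometric-bound : ∀ B K g n → n ≤ B → ∑ B (λ m → shift (suc m ℕ.* suc K) g n) ≡ geometric (suc K) g n
geometric-bound B K g n n≤B = ∑-vanishing-tail B n (λ m → shift (suc m ℕ.* suc K) g n) n≤B
  (λ m n≤m → shift-below (suc m ℕ.* suc K) g n (ℕ.<-≤-trans (s≤s n≤m) (ℕ.m≤m*n (suc m) (suc K))))

geometric-below : ∀ K g n → n ≤ K → geometric (suc K) g n ≡ + 0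
geometric-below K g n n≤K = ∑-zero n
  (λ m _ → shift-below (suc m ℕ.* suc K) g n (ℕ.<-≤-trans (s≤s n≤K) (ℕ.m≤n*m (suc K) (suc m))))

geometric-unfold : ∀ K g → geometric (suc K) g ≗ shift (suc K) (g +ˢ geometric (suc K) g)
geometric-unfold K g zero    = refl
geometric-unfold K g (suc n) = begin
  ∑ (suc n) (λ m → shift (L ℕ.+ m ℕ.* L) g (suc n))              ≡⟨ ∑-cong (suc n) (λ m _ → shift-+ L (m ℕ.* L) g (suc n)) ⟩
  ∑ (suc n) (λ m → shift L (shift (m ℕ.* L) g) (suc n))          ≡⟨ shift-∑ L (suc n) (λ m → shift (m ℕ.* L) g) (suc n) ⟨
  shift L (λ t → ∑ (suc n) (λ m → shift (m ℕ.* L) g t)) (suc n)  ≡⟨ shift-cong< K (suc n) tail ⟩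
  shift L (g +ˢ geometric L g) (suc n)                           ∎
  where
  open ≡-Reasoning
  L : ℕ
  L = suc K
  tail : ∀ t → t < suc n → g t + ∑ n (λ m → shift (suc m ℕ.* L) g t) ≡ g t + geometric L g t
  tail t t<1+n = cong (_+_ (g t)) (geometric-bound n K g t (ℕ.≤-pred t<1+n))

constant : ℤ → Series
constant c zero    = c
constant c (suc _) = + 0

constant-⊛ : ∀ c {a} → a ≗ constant c → ∀ f n → (a ⊛ f) n ≡ c * f n
constant-⊛ c {a} a≗c f n = trans (⊛-cong≤ n {g = f} (λ k _ → a≗c k) (λ _ _ → refl)) (scale n)
  where
  scale : ∀ n → (constant c ⊛ f) n ≡ c * f n
  scale zero    = ⊛-zero (constant c) f
  scale (suc n) = trans (⊛-suc (constant c) f n)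
                        (trans (cong (_+_ (c * f (suc n))) (⊛-zeroˡ f n)) (ℤ.+-identityʳ (c * f (suc n))))

binom-monomial : ∀ c i {a} → a ≗ constant c → binom c (suc i) ≗ (one +ˢ (a ⊛ (q ^ suc i)))
binom-monomial c i {a} a≗c n = sym (begin
  one n + (a ⊛ (q ^ suc i)) n      ≡⟨ cong (_+_ (one n)) (constant-⊛ c a≗c (q ^ suc i) n) ⟩
  one n + c * (q ^ suc i) n        ≡⟨ cong (λ x → one n + c * x) (q^-shift (suc i) n) ⟩
  one n + c * shift (suc i) one n  ≡⟨ coefficient n ⟩
  binom c (suc i) n                ∎)
  where
  open ≡-Reasoning
  scaled-indicator : ∀ b → + 0 + c * (if b then + 1 else + 0) ≡ (if b then c else + 0)
  scaled-indicator true  = trans (ℤ.+-identityˡ _) (ℤ.*-identityʳ c)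
  scaled-indicator false = trans (ℤ.+-identityˡ _) (ℤ.*-zeroʳ c)
  coefficient : ∀ n → one n + c * shift (suc i) one n ≡ binom c (suc i) n
  coefficient zero    = cong (_+_ (+ 1)) (ℤ.*-zeroʳ c)
  coefficient (suc m) = trans (cong (λ x → + 0 + c * x) (shift-one i m)) (scaled-indicator (m ℕ.≡ᵇ i))

≢⇒≡ᵇ≡false : ∀ {m n} → m ≢ n → (m ℕ.≡ᵇ n) ≡ false
≢⇒≡ᵇ≡false {m} {n} m≢n with m ℕ.≡ᵇ n in eq
... | true  = contradiction (ℕ.≡ᵇ⇒≡ m n (subst T (sym eq) _)) m≢n
... | false = refl

binom-below : ∀ c i k → k ≤ i → binom c (suc i) k ≡ one k
binom-below c i zero    _   = refl
binom-below c i (suc k) k<i = cong (if_then c else + 0) (≢⇒≡ᵇ≡false (ℕ.<⇒≢ k<i))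

prodTo-partialPoch : ∀ c {a} → a ≗ constant c → ∀ J → prodTo c J ≗ partialPoch q a J
prodTo-partialPoch c a≗c zero    n = refl
prodTo-partialPoch c a≗c (suc J) n =
  ⊛-cong≤ n (λ k _ → prodTo-partialPoch c a≗c J k) (λ k _ → binom-monomial c J a≗c k)

prodTo-stable : ∀ c N t → t ≤ N → prodTo c (suc N) t ≡ prodTo c N t
prodTo-stable c N t t≤N =
  trans (⊛-cong≤ t {f = prodTo c N} (λ _ _ → refl) (λ k k≤t → binom-below c N k (ℕ.≤-trans k≤t t≤N)))
        (ˢ.*-identityʳ (prodTo c N) t)

stabilises : ∀ (F : ℕ → Series) → (∀ K t → t ≤ K → F (suc K) t ≡ F K t) → ∀ {K t} → t ≤ K → F K t ≡ F t t
stabilises F step t≤K = go (ℕ.≤⇒≤′ t≤K)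
  where
  go : ∀ {K t} → t ℕ.≤′ K → F K t ≡ F t t
  go ℕ.≤′-refl            = refl
  go (ℕ.≤′-step {K} t≤′K) = trans (step K _ (ℕ.≤′⇒≤ t≤′K)) (go t≤′K)

invRev-downFrom : ∀ f n → invRev f n ≡ map (inv f) (downFrom (suc n))
invRev-downFrom f zero    = refl
invRev-downFrom f (suc n) = cong (inv f (suc n) ∷_) (invRev-downFrom f n)

sum-zipWith-downFrom : ∀ n (a b : Series) →
  sum (zipWith _*_ (applyUpTo a (suc n)) (map b (downFrom (suc n)))) ≡ ∑ (suc n) (λ k → a k * b (n ∸ k))
sum-zipWith-downFrom zero    a b = refl
sum-zipWith-downFrom (suc n) a b = cong (_+_ (a 0 * b (suc n))) (sum-zipWith-downFrom n (a ∘ suc) b)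

inv-suc : ∀ f n → inv f (suc n) ≡ - ((f ∘ suc) ⊛ inv f) n
inv-suc f n = cong -_ (begin
  sum (zipWith _*_ (map f (applyUpTo suc (suc n))) (invRev f n))
    ≡⟨ cong₂ (λ xs ys → sum (zipWith _*_ xs ys)) (List.map-applyUpTo suc f (suc n)) (invRev-downFrom f n) ⟩
  sum (zipWith _*_ (applyUpTo (f ∘ suc) (suc n)) (map (inv f) (downFrom (suc n))))
    ≡⟨ sum-zipWith-downFrom n (f ∘ suc) (inv f) ⟩
  ∑ (suc n) (λ k → f (suc k) * inv f (n ∸ k))
    ≡⟨ ⊛-∑ (f ∘ suc) (inv f) n ⟨
  ((f ∘ suc) ⊛ inv f) n ∎)
  where open ≡-Reasoning

⊛-inverseʳ : ∀ f → f 0 ≡ + 1 → (f ⊛ inv f) ≗ one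
⊛-inverseʳ f f0≡1 zero    = trans (⊛-zero f (inv f)) (trans (ℤ.*-identityʳ (f 0)) f0≡1)
⊛-inverseʳ f f0≡1 (suc n) = begin
  (f ⊛ inv f) (suc n)                         ≡⟨ ⊛-suc f (inv f) n ⟩
  f 0 * inv f (suc n) + ((f ∘ suc) ⊛ inv f) n ≡⟨ cong₂ (λ a b → a * b + s) f0≡1 (inv-suc f n) ⟩
  + 1 * - s + s                               ≡⟨ cong (_+ s) (ℤ.*-identityˡ (- s)) ⟩
  - s + s                                     ≡⟨ ℤ.+-inverseˡ s ⟩
  + 0                                         ∎
  where
  open ≡-Reasoning
  s : ℤ
  s = ((f ∘ suc) ⊛ inv f) n

-- Overpartitions: missing integers and the block of largest parts

sgn : ℕ → ℤ
sgn m = if even m then + 1 else - + 1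

sgn-suc : ∀ m → sgn (suc m) ≡ - sgn m
sgn-suc zero    = refl
sgn-suc (suc m) = trans (sym (ℤ.neg-involutive (sgn m))) (cong -_ (sym (sgn-suc m)))

≡ᵇ-refl : ∀ n → (n ℕ.≡ᵇ n) ≡ true
≡ᵇ-refl zero    = refl
≡ᵇ-refl (suc n) = ≡ᵇ-refl n

occurs-++ : ∀ i b o → occurs i (b ++ o) ≡ occurs i b ∨ occurs i o
occurs-++ i []            o = refl
occurs-++ i ((p , _) ∷ b) o = trans (cong (_∨_ (i ℕ.≡ᵇ p)) (occurs-++ i b o)) (sym (Bool.∨-assoc (i ℕ.≡ᵇ p) _ _))

any-replicate : ∀ {A : Set} (f : A → Bool) j x → any f (replicate (suc j) x) ≡ f x
any-replicate f zero    x = Bool.∨-identityʳ (f x)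
any-replicate f (suc j) x = trans (cong (_∨_ (f x)) (any-replicate f j x)) (Bool.∨-idem (f x))

occurs-block : ∀ {i j p} b → map proj₁ b ≡ replicate (suc j) p → occurs i b ≡ (i ℕ.≡ᵇ p)
occurs-block {i} {j} {p} b parts = trans (cong (any (i ℕ.≡ᵇ_)) parts) (any-replicate (i ℕ.≡ᵇ_) j p)

occurs-above : ∀ i o → largestPart o < i → occurs i o ≡ false
occurs-above i []            _  = refl
occurs-above i ((p , _) ∷ o) lt = cong₂ _∨_
  (≢⇒≡ᵇ≡false (ℕ.>⇒≢ (ℕ.m⊔n<o⇒m<o p (largestPart o) lt)))
  (occurs-above i o (ℕ.m⊔n<o⇒n<o p (largestPart o) lt))

largestPart-block : ∀ {j p} b o → map proj₁ b ≡ replicate (suc j) p → largestPart o ≤ p → largestPart (b ++ o) ≡ p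
largestPart-block {j} {p} b o parts o≤p = begin
  foldr _⊔_ 0 (map proj₁ (b ++ o))                       ≡⟨ cong (foldr _⊔_ 0) (List.map-++ proj₁ b o) ⟩
  foldr _⊔_ 0 (map proj₁ b ++ map proj₁ o)               ≡⟨ List.foldr-++ _⊔_ 0 (map proj₁ b) (map proj₁ o) ⟩
  foldr _⊔_ (largestPart o) (map proj₁ b)                ≡⟨ cong (foldr _⊔_ (largestPart o)) parts ⟩
  foldr _⊔_ (largestPart o) (replicate (suc j) p)        ≡⟨ ⊔-replicate j ⟩
  p                                                      ∎
  where
  open ≡-Reasoning
  ⊔-replicate : ∀ j → foldr _⊔_ (largestPart o) (replicate (suc j) p) ≡ p
  ⊔-replicate zero    = ℕ.m≥n⇒m⊔n≡m o≤p
  ⊔-replicate (suc j) = trans (cong (p ⊔_) (⊔-replicate j)) (ℕ.⊔-idem p)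

missingUpTo : ℕ → Overpartition → ℕ
missingUpTo k o = length (filterᵇ (λ i → not (occurs i o)) (applyUpTo suc k))

absent : ℕ → Overpartition → ℕ
absent i o = if not (occurs i o) then 1 else 0

length-filterᵇ-∷ʳ : ∀ {A : Set} (p : A → Bool) xs x →
                    length (filterᵇ p (xs ∷ʳ x)) ≡ length (filterᵇ p xs) ℕ.+ (if p x then 1 else 0)
length-filterᵇ-∷ʳ p [] x with p x
... | true  = refl
... | false = refl
length-filterᵇ-∷ʳ p (y ∷ xs) x with p y
... | true  = cong suc (length-filterᵇ-∷ʳ p xs x)
... | false = length-filterᵇ-∷ʳ p xs x

missingUpTo-suc : ∀ k o → missingUpTo (suc k) o ≡ missingUpTo k o ℕ.+ absent (suc k) o
missingUpTo-suc k o = trans (cong (length ∘ filterᵇ (λ i → not (occurs i o))) (sym (List.applyUpTo-∷ʳ suc k)))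
                            (length-filterᵇ-∷ʳ (λ i → not (occurs i o)) (applyUpTo suc k) (suc k))

missingUpTo-cong : ∀ k o o′ → (∀ i → i < k → occurs (suc i) o ≡ occurs (suc i) o′) → missingUpTo k o ≡ missingUpTo k o′
missingUpTo-cong zero    o o′ eq = refl
missingUpTo-cong (suc k) o o′ eq = begin
  missingUpTo (suc k) o                   ≡⟨ missingUpTo-suc k o ⟩
  missingUpTo k o ℕ.+ absent (suc k) o    ≡⟨ cong₂ ℕ._+_ (missingUpTo-cong k o o′ (λ i i<k → eq i (ℕ.m<n⇒m<1+n i<k)))
                                                         (cong (λ b → if not b then 1 else 0) (eq k (ℕ.n<1+n k))) ⟩
  missingUpTo k o′ ℕ.+ absent (suc k) o′  ≡⟨ missingUpTo-suc k o′ ⟨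
  missingUpTo (suc k) o′                  ∎
  where open ≡-Reasoning

missingUpTo-fresh : ∀ k o → largestPart o ≤ k → missingUpTo (suc k) o ≡ suc (missingUpTo k o)
missingUpTo-fresh k o o≤k = begin
  missingUpTo (suc k) o                 ≡⟨ missingUpTo-suc k o ⟩
  missingUpTo k o ℕ.+ absent (suc k) o  ≡⟨ cong (λ b → missingUpTo k o ℕ.+ (if not b then 1 else 0))
                                                (occurs-above (suc k) o (s≤s o≤k)) ⟩
  missingUpTo k o ℕ.+ 1                 ≡⟨ ℕ.+-comm (missingUpTo k o) 1 ⟩
  suc (missingUpTo k o)                 ∎
  where open ≡-Reasoning

module _ {j k} (b o : Overpartition) (parts : map proj₁ b ≡ replicate (suc j) (suc k)) where

  missingUpTo-block : missingUpTo k (b ++ o) ≡ missingUpTo k o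
  missingUpTo-block = missingUpTo-cong k (b ++ o) o λ i i<k → begin
    occurs (suc i) (b ++ o)                     ≡⟨ occurs-++ (suc i) b o ⟩
    occurs (suc i) b ∨ occurs (suc i) o         ≡⟨ cong (_∨ occurs (suc i) o) (occurs-block {suc i} b parts) ⟩
    (i ℕ.≡ᵇ k) ∨ occurs (suc i) o               ≡⟨ cong (_∨ occurs (suc i) o) (≢⇒≡ᵇ≡false (ℕ.<⇒≢ i<k)) ⟩
    occurs (suc i) o                            ∎
    where open ≡-Reasoning

  missingUpTo-suc-block : missingUpTo (suc k) (b ++ o) ≡ missingUpTo k o
  missingUpTo-suc-block = begin
    missingUpTo (suc k) (b ++ o)                ≡⟨ missingUpTo-suc k (b ++ o) ⟩
    missingUpTo k (b ++ o) ℕ.+ absent (suc k) (b ++ o)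
                                                ≡⟨ cong (λ x → missingUpTo k (b ++ o) ℕ.+ (if not x then 1 else 0)) occurs-k ⟩
    missingUpTo k (b ++ o) ℕ.+ 0                ≡⟨ ℕ.+-identityʳ _ ⟩
    missingUpTo k (b ++ o)                      ≡⟨ missingUpTo-block ⟩
    missingUpTo k o                             ∎
    where
    open ≡-Reasoning
    occurs-k : occurs (suc k) (b ++ o) ≡ true
    occurs-k = trans (occurs-++ (suc k) b o)
                     (cong (_∨ occurs (suc k) o) (trans (occurs-block {suc k} b parts) (≡ᵇ-refl k)))

  missing-block : largestPart o ≤ k → missing (b ++ o) ≡ missingUpTo k o
  missing-block o≤k = trans (cong (λ L → missingUpTo (L ∸ 1) (b ++ o)) (largestPart-block b o parts (ℕ.m≤n⇒m≤1+n o≤k)))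
                            missingUpTo-block

blocks-parts : ∀ p j → All (λ b → map proj₁ b ≡ replicate (suc j) p) (blocks p (suc j))
blocks-parts p j = cong (p ∷_) (List.map-replicate proj₁ j (p , false)) ∷ List.map-replicate proj₁ (suc j) (p , false) ∷ []

-- The m-th summand of `opsBelow (suc k) n`: the overpartitions in which k+1 occurs m times.
layer : ℕ → ℕ → ℕ → List Overpartition
layer k n m = if m ℕ.* suc k ℕ.≤ᵇ n
                then concatMap (λ b → map (b ++_) (opsBelow k (n ∸ m ℕ.* suc k))) (blocks (suc k) m)
                else []

opsBelow-bounded : ∀ k n → All (λ o → largestPart o ≤ k) (opsBelow k n)
opsBelow-bounded zero    zero    = z≤n ∷ []
opsBelow-bounded zero    (suc n) = []
opsBelow-bounded (suc k) n       = All.concat⁺ (All.map⁺ (All.applyUpTo⁺₂ id (suc n) layer-bounded))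
  where
  Bounded : List Overpartition → Set
  Bounded = All (λ o → largestPart o ≤ suc k)
  block-bounded : ∀ t j b → map proj₁ b ≡ replicate (suc j) (suc k) → Bounded (map (b ++_) (opsBelow k t))
  block-bounded t j b parts =
    All.map⁺ (All.map (λ {o} o≤k → ℕ.≤-reflexive (largestPart-block b o parts (ℕ.m≤n⇒m≤1+n o≤k))) (opsBelow-bounded k t))
  layer-bounded : ∀ m → Bounded (layer k n m)
  layer-bounded zero = All.++⁺ (All.map⁺ (All.map ℕ.m≤n⇒m≤1+n (opsBelow-bounded k n))) []
  layer-bounded (suc j) with suc j ℕ.* suc k ℕ.≤ᵇ n
  ... | true  = All.concat⁺ (All.map⁺ (All.map (block-bounded (n ∸ suc j ℕ.* suc k) j _) (blocks-parts (suc k) j)))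
  ... | false = []

weightedCount : ℕ → (Overpartition → ℤ) → Series
weightedCount k w n = sum (map w (opsBelow k n))

weightedCount-prefixed : ∀ k (w v : Overpartition → ℤ) b → (∀ o → largestPart o ≤ k → w (b ++ o) ≡ v o) →
                         ∀ t → sum (map w (map (b ++_) (opsBelow k t))) ≡ weightedCount k v t
weightedCount-prefixed k w v b eq t = trans (cong sum (sym (List.map-∘ (opsBelow k t))))
                                            (sum-map-cong (All.map (λ {o} → eq o) (opsBelow-bounded k t)))

-- An overpartition with parts ≤ k+1 is a block of m copies of k+1 (for m ≥ 1 the first
-- copy may be overlined, in two ways) followed by an overpartition with parts ≤ k.
weightedCount-suc :
  ∀ k (w w₀ w₁ : Overpartition → ℤ) →
  (∀ o → largestPart o ≤ k → w o ≡ w₀ o) →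
  (∀ j b o → map proj₁ b ≡ replicate (suc j) (suc k) → largestPart o ≤ k → w (b ++ o) ≡ w₁ o) →
  ∀ n → weightedCount (suc k) w n ≡ weightedCount k w₀ n + + 2 * geometric (suc k) (weightedCount k w₁) n
weightedCount-suc k w w₀ w₁ w≡w₀ w≡w₁ n = begin
  weightedCount (suc k) w n
    ≡⟨⟩
  sum (map w (concatMap (layer k n) (upTo (suc n))))
    ≡⟨ sum-map-concatMap w (layer k n) (upTo (suc n)) ⟩
  sum (map (λ m → sum (map w (layer k n m))) (upTo (suc n)))
    ≡⟨ cong sum (List.map-upTo (λ m → sum (map w (layer k n m))) (suc n)) ⟩
  sum (map w (layer k n 0)) + ∑ n (λ m → sum (map w (layer k n (suc m))))
    ≡⟨ cong₂ _+_ layer-zero (∑-cong n (λ m _ → layer-suc m)) ⟩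
  weightedCount k w₀ n + ∑ n (λ m → + 2 * shift (suc m ℕ.* suc k) (weightedCount k w₁) n)
    ≡⟨ cong (_+_ (weightedCount k w₀ n)) (∑-distribˡ-* n (+ 2) (λ m → shift (suc m ℕ.* suc k) (weightedCount k w₁) n)) ⟩
  weightedCount k w₀ n + + 2 * geometric (suc k) (weightedCount k w₁) n
    ∎
  where
  open ≡-Reasoning
  layer-zero : sum (map w (layer k n 0)) ≡ weightedCount k w₀ n
  layer-zero = trans (sum-map-++ w (map ([] ++_) (opsBelow k n)) [])
                     (trans (ℤ.+-identityʳ _) (weightedCount-prefixed k w w₀ [] w≡w₀ n))
  twice : ∀ x → x + (x + + 0) ≡ + 2 * x
  twice = solve-∀
  blocksAt : ℕ → ℕ → List Overpartition
  blocksAt j t = concatMap (λ b → map (b ++_) (opsBelow k t)) (blocks (suc k) (suc j))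
  blocks-sum : ∀ j t → sum (map w (blocksAt j t)) ≡ + 2 * weightedCount k w₁ t
  blocks-sum j t = trans (sum-map-concatMap w (λ b → map (b ++_) (opsBelow k t)) (blocks (suc k) (suc j)))
                  (trans (sum-map-cong (All.map (λ {b} parts → weightedCount-prefixed k w w₁ b (λ o → w≡w₁ j b o parts) t)
                                                (blocks-parts (suc k) j)))
                         (twice (weightedCount k w₁ t)))
  layer-suc : ∀ m → sum (map w (layer k n (suc m))) ≡ + 2 * shift (suc m ℕ.* suc k) (weightedCount k w₁) n
  layer-suc m = begin
    sum (map w (layer k n (suc m)))                               ≡⟨ Bool.if-float (sum ∘ map w) (a ℕ.≤ᵇ n) ⟩
    (if a ℕ.≤ᵇ n then sum (map w (blocksAt m (n ∸ a))) else + 0)  ≡⟨ shift-if a (λ t → sum (map w (blocksAt m t))) n ⟩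
    shift a (λ t → sum (map w (blocksAt m t))) n                  ≡⟨ shift-cong a (blocks-sum m) n ⟩
    shift a (λ t → + 2 * weightedCount k w₁ t) n                  ≡⟨ shift-* a (+ 2) (weightedCount k w₁) n ⟩
    + 2 * shift a (weightedCount k w₁) n                          ∎
    where
    a : ℕ
    a = suc m ℕ.* suc k

signedMissingUpTo : ℕ → Series
signedMissingUpTo k = weightedCount k (λ o → sgn (missingUpTo k o))

signedMissing : ℕ → Series
signedMissing k = weightedCount k (λ o → sgn (missing o))

signedMissingStep : ℕ → Series
signedMissingStep K = geometric (suc K) (signedMissingUpTo K)

signedMissingUpTo-zero : signedMissingUpTo 0 ≗ one
signedMissingUpTo-zero zero    = refl
signedMissingUpTo-zero (suc n) = refl

signedMissing-zero : signedMissing 0 ≗ one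
signedMissing-zero zero    = refl
signedMissing-zero (suc n) = refl

2#≗constant : 2# ≗ constant (+ 2)
2#≗constant zero    = refl
2#≗constant (suc n) = refl

signedMissingUpTo-suc : ∀ k → (signedMissingUpTo (suc k) +ˢ signedMissingUpTo k) ≗ (2# ⊛ signedMissingStep k)
signedMissingUpTo-suc k n = begin
  D (suc k) n + D k n                                                 ≡⟨ cong (_+ D k n) decomposition ⟩
  weightedCount k (λ o → - sgn (missingUpTo k o)) n + + 2 * g + D k n ≡⟨ cong (λ x → x + + 2 * g + D k n)
                                                                              (sum-map-neg (λ o → sgn (missingUpTo k o)) (opsBelow k n)) ⟩
  - D k n + + 2 * g + D k n                                           ≡⟨ cancel (D k n) g ⟩
  + 2 * g                                                             ≡⟨ constant-⊛ (+ 2) 2#≗constant (signedMissingStep k) n ⟨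
  (2# ⊛ signedMissingStep k) n                                        ∎
  where
  open ≡-Reasoning
  D : ℕ → Series
  D = signedMissingUpTo
  g : ℤ
  g = signedMissingStep k n
  decomposition : D (suc k) n ≡ weightedCount k (λ o → - sgn (missingUpTo k o)) n + + 2 * g
  decomposition = weightedCount-suc k (λ o → sgn (missingUpTo (suc k) o)) (λ o → - sgn (missingUpTo k o))
    (λ o → sgn (missingUpTo k o))
    (λ o o≤k → trans (cong sgn (missingUpTo-fresh k o o≤k)) (sgn-suc (missingUpTo k o)))
    (λ j b o parts _ → cong sgn (missingUpTo-suc-block b o parts))
    n
  cancel : ∀ x y → - x + + 2 * y + x ≡ + 2 * y
  cancel = solve-∀

signedMissing-suc : ∀ k n → signedMissing (suc k) n ≡ signedMissing k n + + 2 * signedMissingStep k n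
signedMissing-suc k = weightedCount-suc k (λ o → sgn (missing o)) (λ o → sgn (missing o)) (λ o → sgn (missingUpTo k o))
  (λ _ _ → refl) (λ j b o parts o≤k → cong sgn (missing-block b o parts o≤k))

signedMissing-stable : ∀ K t → t ≤ K → signedMissing (suc K) t ≡ signedMissing K t
signedMissing-stable K t t≤K = begin
  signedMissing (suc K) t                        ≡⟨ signedMissing-suc K t ⟩
  signedMissing K t + + 2 * signedMissingStep K t ≡⟨ cong (λ x → signedMissing K t + + 2 * x)
                                                         (geometric-below K (signedMissingUpTo K) t t≤K) ⟩
  signedMissing K t + + 0                        ≡⟨ ℤ.+-identityʳ _ ⟩
  signedMissing K t                              ∎
  where open ≡-Reasoning

signedMissingStep-unfold : ∀ K → signedMissingStep K ≗ ((q ^ suc K) ⊛ (signedMissingUpTo K +ˢ signedMissingStep K))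
signedMissingStep-unfold K n =
  trans (geometric-unfold K (signedMissingUpTo K) n) (sym (q^-⊛ (suc K) (signedMissingUpTo K +ˢ signedMissingStep K) n))

signedMissing≗G : ∀ K → signedMissing K ≗ G q signedMissingUpTo signedMissingStep 0 K
signedMissing≗G zero      = signedMissing-zero
signedMissing≗G (suc K) n = begin
  signedMissing (suc K) n                            ≡⟨ signedMissing-suc K n ⟩
  signedMissing K n + + 2 * E n                      ≡⟨ cong₂ _+_ (signedMissing≗G K n) (cong (+ 2 *_) (sym (⊛-identityˡ E n))) ⟩
  G₀ K n + + 2 * (one ⊛ E) n                         ≡⟨ cong (_+_ (G₀ K n)) (constant-⊛ (+ 2) 2#≗constant (one ⊛ E) n) ⟨
  G₀ K n + (2# ⊛ (one ⊛ E)) n                        ∎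
  where
  open ≡-Reasoning
  E : Series
  E = signedMissingStep K
  G₀ : ℕ → Series
  G₀ = G q signedMissingUpTo signedMissingStep 0

signedMissing∞ : Series
signedMissing∞ n = signedMissing n n

product-formula : ∀ n → (signedMissing∞ ⊛ pochNeg (+ 1)) n ≡ pochNeg (+ 3) n
product-formula n = begin
  (signedMissing∞ ⊛ pochNeg (+ 1)) n
    ≡⟨ ⊛-cong≤ n (λ t t≤n → sym (stabilises signedMissing signedMissing-stable t≤n))
                 (λ t t≤n → sym (stabilises (prodTo (+ 1)) (prodTo-stable (+ 1)) t≤n)) ⟩
  (signedMissing n ⊛ prodTo (+ 1) n) n
    ≡⟨ ⊛-cong≤ n (λ t _ → signedMissing≗G n t) (λ t _ → prodTo-partialPoch (+ 1) 1≗constant n t) ⟩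
  (G₀ ⊛ partialPoch q one n) n
    ≡⟨ coefficient-mod-q^ n (G₀ ⊛ partialPoch q one n) (partialPoch q 3# n)
         (product-congruence q signedMissingUpTo signedMissingStep
                             signedMissingUpTo-zero signedMissingUpTo-suc signedMissingStep-unfold n) ⟩
  partialPoch q 3# n n
    ≡⟨ prodTo-partialPoch (+ 3) 3≗constant n n ⟨
  prodTo (+ 3) n n ∎
  where
  open ≡-Reasoning
  G₀ : Series
  G₀ = G q signedMissingUpTo signedMissingStep 0 n
  1≗constant : one ≗ constant (+ 1)
  1≗constant zero    = refl
  1≗constant (suc n) = refl
  3≗constant : 3# ≗ constant (+ 3)
  3≗constant zero    = refl
  3≗constant (suc n) = refl

rhs≗signedMissing∞ : rhs ≗ signedMissing∞
rhs≗signedMissing∞ n = begin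
  (pochNeg (+ 3) ⊛ inv P₁) n                 ≡⟨ ⊛-cong≤ n {g = inv P₁} (λ t _ → sym (product-formula t)) (λ _ _ → refl) ⟩
  ((signedMissing∞ ⊛ P₁) ⊛ inv P₁) n         ≡⟨ ⊛-assoc signedMissing∞ P₁ (inv P₁) n ⟩
  (signedMissing∞ ⊛ (P₁ ⊛ inv P₁)) n         ≡⟨ ⊛-cong≤ n {f = signedMissing∞} (λ _ _ → refl)
                                                        (λ t _ → ⊛-inverseʳ P₁ refl t) ⟩
  (signedMissing∞ ⊛ one) n                   ≡⟨ ˢ.*-identityʳ signedMissing∞ n ⟩
  signedMissing∞ n                           ∎
  where
  open ≡-Reasoning
  P₁ : Series
  P₁ = pochNeg (+ 1)

missing≤largestPart : ∀ o → missing o ≤ largestPart o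
missing≤largestPart o = begin
  missing o                                  ≤⟨ List.length-filter (T? ∘ (λ i → not (occurs i o))) (applyUpTo suc (largestPart o ∸ 1)) ⟩
  length (applyUpTo suc (largestPart o ∸ 1)) ≡⟨ List.length-applyUpTo suc (largestPart o ∸ 1) ⟩
  largestPart o ∸ 1                          ≤⟨ ℕ.m∸n≤m (largestPart o) 1 ⟩
  largestPart o                              ∎
  where open ℕ.≤-Reasoning

signedSum≡signedMissing∞ : ∀ n → signedSum n ≡ signedMissing∞ n
signedSum≡signedMissing∞ n = begin
  sum (map (λ m → sgn m * + Pbar n m) (upTo (suc n)))
    ≡⟨ cong sum (List.map-upTo (λ m → sgn m * + Pbar n m) (suc n)) ⟩
  ∑ (suc n) (λ m → sgn m * + Pbar n m)
    ≡⟨ ∑-cong (suc n) (λ m _ → trans (cong (sgn m *_) (count-as-sum (λ o → missing o ℕ.≡ᵇ m) L))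
                                     (sym (sum-map-* (sgn m) (δ m) L))) ⟩
  ∑ (suc n) (λ m → sum (map (λ o → sgn m * δ m o) L))
    ≡⟨ ∑-sum-comm (suc n) (λ m o → sgn m * δ m o) L ⟩
  sum (map (λ o → ∑ (suc n) (λ m → sgn m * δ m o)) L)
    ≡⟨ sum-map-cong (All.map (λ {o} o≤n → ∑-indicator (suc n) (missing o) sgn (s≤s (ℕ.≤-trans (missing≤largestPart o) o≤n)))
                             (opsBelow-bounded n n)) ⟩
  sum (map (λ o → sgn (missing o)) L)
    ∎
  where
  open ≡-Reasoning
  L : List Overpartition
  L = overpartitions n
  δ : ℕ → Overpartition → ℤ
  δ m o = if missing o ℕ.≡ᵇ m then + 1 else + 0

Me-Mo≡signedMissing∞ : ∀ n → + Me n - + Mo n ≡ signedMissing∞ n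
Me-Mo≡signedMissing∞ n = count-difference (λ o → even (missing o)) (overpartitions n)

corollary3p5 : (n : ℕ) →
    (signedSum n ≡ + Me n - + Mo n) × (+ Me n - + Mo n ≡ rhs n)
corollary3p5 n = trans (signedSum≡signedMissing∞ n) (sym (Me-Mo≡signedMissing∞ n))
               , trans (Me-Mo≡signedMissing∞ n) (sym (rhs≗signedMissing∞ n))
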